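{- Let $r$ be a positive integer and let $F_m$ denote the $m$-th Fibonacci number ($F_1=F_2=1$, $F_{m+2}=F_{m+1}+F_m$). If $r$ is odd, then $b_4\big([(1\;2)^{\lceil r/2\rceil}]_4\big)=F_{r+3}$. If $r$ is even, then $b_4\big([(1\;2)^{r/2}\;2]_4\big)=F_{r+3}$. In both cases, $F_{r+3}$ is the maximal value of $b_4(n)$ over integers $n$ in the interval $$\Big[-[\underbrace{1\;1\;\cdots\;1}_{r+1}]_4,\;[\underbrace{1\;1\;\cdots\;1}_{r+2}]_4\Big].$$
   Context: For an integer $n$, a balanced quaternary representation of $n$ is an expression $n=\sum_{i\ge 0}\epsilon_i 4^i$ with finitely many nonzero $\epsilon_i$ and all $\epsilon_i\in\{ -2,-1,0,1,2\}$ (representations differing only by leading zeros are identified); $b_4(n)$ denotes the number of such representations. Notation: $[\epsilon_k\;\cdots\;\epsilon_0]_4=\sum_{i=0}^k\epsilon_i4^i$; $[\underbrace{1\;\cdots\;1}_{m}]_4$ denotes the string of $m$ ones; $(1\;2)^t$ denotes the digit block $1\;2$ repeated $t$ times, e.g. $[(1\;2)^2]_4=[1\;2\;1\;2]_4$ and $[(1\;2)^{1}\;2]_4=[1\;2\;2]_4$. -}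

module Defs where

open import Data.Nat using (ℕ; zero; suc)
open import Data.Integer using (ℤ; +_; -_; _+_; _*_; _≤_; 0ℤ)
open import Data.List using (List; []; _∷_; _∷ʳ_; foldl; length; replicate)
open import Data.List.Relation.Unary.All using (All)
open import Data.List.Relation.Unary.Unique.Propositional using (Unique)
open import Data.List.Membership.Propositional using (_∈_)
open import Data.Product using (Σ; ∃; _×_)
open import Relation.Nullary using (¬_)
open import Relation.Binary.PropositionalEquality using (_≡_)

fib : ℕ → ℕ
fib zero = zero
fib (suc zero) = suc zero
fib (suc (suc m)) = fib (suc m) Data.Nat.+ fib m

-- A balanced quaternary digit string, little-endian: ds = ε₀ ∷ ε₁ ∷ … ∷ ε_k
-- value: Σ εᵢ 4^i
valLE : List ℤ → ℤ
valLE [] = 0ℤ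
valLE (d ∷ ds) = d + + 4 * valLE ds

BalDigit : ℤ → Set
BalDigit d = (- + 2 ≤ d) × (d ≤ + 2)

-- canonical representative modulo leading zeros: most significant digit nonzero
NoLeadingZero : List ℤ → Set
NoLeadingZero ds = ¬ (∃ λ zs → ds ≡ zs ∷ʳ 0ℤ)

IsRep : ℤ → List ℤ → Set
IsRep n ds = All BalDigit ds × NoLeadingZero ds × valLE ds ≡ n

-- "b₄(n) = k": the set of representations of n is finite with exactly k elements,
-- i.e. it is enumerated by a duplicate-free list of length k.
B4 : ℤ → ℕ → Set
B4 n k = Σ (List (List ℤ)) λ L →
  Unique L × (∀ ds → ds ∈ L → IsRep n ds) × (∀ ds → IsRep n ds → ds ∈ L) × length L ≡ k

-- big-endian notation [ε_k … ε₀]₄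
valBE : List ℤ → ℤ
valBE = foldl (λ acc d → + 4 * acc + d) 0ℤ

blk12 : ℕ → List ℤ
blk12 zero = []
blk12 (suc t) = + 1 ∷ + 2 ∷ blk12 t

ones : ℕ → List ℤ
ones m = replicate m (+ 1)

{-# OPTIONS --safe #-}
module Submission where

-- The lowest digit d of a representation of x ∈ ℕ is forced by x mod 4, except that x ≡ 2 allows
-- both d = 2 and d = −2, and the rest of the representation represents (x − d)/4 ≥ 0. Hence
-- b₄(0) = 1, b₄(4m+1) = b₄(m), b₄(4m+2) = b₄(m) + b₄(m+1), b₄(4m+3) = b₄(4m+4) = b₄(m+1), and
-- b₄(−n) = b₄(n) by negating digits. Following this recursion, induction on s shows that below the
-- repunit [1 … 1]₄ with s ones, b₄(k) ≤ F(s+1) and b₄(k) + b₄(k+1) ≤ F(s+2). Along the digit string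
-- (1 2)^t the pair (b₄(n), b₄(n+1)) runs through consecutive Fibonacci numbers, so the bound is
-- attained at [(1 2)^t]₄ and [(1 2)^t 2]₄.

open import Defs
open import Data.Nat using (ℕ; zero; suc; z<s; z≤n; s≤s; _+_; _*_; _%_; _/_; ⌈_/2⌉; ⌊_/2⌋)
import Data.Nat as ℕ
open import Data.Nat.Properties
  using (≤-refl; ≤-reflexive; ≤-trans; ≤-antisym; ≤-<-trans; <⇒≤; n≤1+n; n<1+n; m≤m+n; m≤n+m; m<n+m;
         m≤m*n; +-comm; +-mono-≤; *-monoʳ-≤; *-monoˡ-≤; *-monoˡ-<; *-cancelʳ-≤; *-cancelʳ-<; 0≢1+n; 1+n≢0)
open import Data.Nat.DivMod using (m*n%n≡0; m*n/n≡m; [m+kn]%n≡m%n)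
open import Data.Integer using (ℤ; +_; -[1+_]; -_; 0ℤ; _≤_; +≤+; -≤-; -≤+; ∣_∣)
import Data.Integer as ℤ
import Data.Integer.Properties as ℤₚ
open import Data.List using (List; []; _∷_; _∷ʳ_; _++_; [_]; map; length; replicate)
open import Data.List.Properties
  using (∷-injectiveˡ; ∷-injectiveʳ; map-++; map-injective; length-map; length-++; length-++-sucʳ; foldl-∷ʳ)
open import Data.List.Relation.Unary.All as All using ([]; _∷_)
open import Data.List.Relation.Unary.All.Properties using (map⁺)
open import Data.List.Relation.Unary.Any using (here; there)
open import Data.List.Relation.Unary.AllPairs using ([]; _∷_)
open import Data.List.Relation.Unary.Unique.Propositional using (Unique)
import Data.List.Relation.Unary.Unique.Propositional.Properties as Unique
open import Data.List.Relation.Binary.Disjoint.Propositional using (Disjoint)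
open import Data.List.Relation.Binary.Subset.Propositional using (_⊆_)
open import Data.List.Membership.Propositional using (_∈_)
open import Data.List.Membership.Propositional.Properties using (∈-map⁺; ∈-map⁻; ∈-++⁺ˡ; ∈-++⁺ʳ; ∈-++⁻; ∈-∃++)
open import Data.Product using (∃; ∃-syntax; _×_; _,_)
open import Data.Sum using (_⊎_; inj₁; inj₂; [_,_]′)
open import Relation.Nullary using (contradiction)
open import Relation.Binary.PropositionalEquality
  using (_≡_; _≢_; refl; sym; trans; cong; cong₂; subst; subst₂; module ≡-Reasoning)

Unique⇒⊆⇒length≤ : ∀ {a} {A : Set a} {xs ys : List A} → Unique xs → xs ⊆ ys → length xs ℕ.≤ length ys
Unique⇒⊆⇒length≤ {xs = []}     _            _       = z≤n
Unique⇒⊆⇒length≤ {xs = x ∷ xs} (x∉xs ∷ uxs) x∷xs⊆ys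
  with ys₁ , ys₂ , refl ← ∈-∃++ (x∷xs⊆ys (here refl)) =
  ≤-trans (s≤s (Unique⇒⊆⇒length≤ uxs xs⊆ys₁ys₂)) (≤-reflexive (sym (length-++-sucʳ ys₁ x ys₂)))
  where
  xs⊆ys₁ys₂ : xs ⊆ ys₁ ++ ys₂
  xs⊆ys₁ys₂ y∈xs with ∈-++⁻ ys₁ (x∷xs⊆ys (there y∈xs))
  ... | inj₁ y∈ys₁         = ∈-++⁺ˡ y∈ys₁
  ... | inj₂ (here refl)   = contradiction refl (All.lookup x∉xs y∈xs)
  ... | inj₂ (there y∈ys₂) = ∈-++⁺ʳ ys₁ y∈ys₂

pos-4* : ∀ q → + 4 ℤ.* + q ≡ + (q * 4)
pos-4* q = trans (ℤₚ.*-comm (+ 4) (+ q)) (sym (ℤₚ.pos-* q 4))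

data Base4View : ℕ → Set where
  4*_+0 : ∀ m → Base4View (m * 4)
  4*_+1 : ∀ m → Base4View (1 + m * 4)
  4*_+2 : ∀ m → Base4View (2 + m * 4)
  4*_+3 : ∀ m → Base4View (3 + m * 4)

base4 : ∀ x → Base4View x
base4 zero = 4* 0 +0
base4 (suc x) with base4 x
... | 4* m +0 = 4* m +1
... | 4* m +1 = 4* m +2
... | 4* m +2 = 4* m +3
... | 4* m +3 = 4* suc m +0

base4-m*4 : ∀ m → base4 (m * 4) ≡ 4* m +0
base4-m*4 zero    = refl
base4-m*4 (suc m) rewrite base4-m*4 m = refl

-- The ways of peeling the lowest digit d off a representation of x > 0, leaving a representation
-- of q: x = d + 4q with (d , q) ≠ (0 , 0).
data Split : ℕ → ℤ → ℕ → Set where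
  split+0 : ∀ m → Split (suc m * 4) (+ 0)    (suc m)
  split+1 : ∀ m → Split (1 + m * 4) (+ 1)    m
  split+2 : ∀ m → Split (2 + m * 4) (+ 2)    m
  split-2 : ∀ m → Split (2 + m * 4) -[1+ 1 ] (suc m)
  split-1 : ∀ m → Split (3 + m * 4) -[1+ 0 ] (suc m)

split-digit : ∀ {x d q} → Split x d q → BalDigit d
split-digit (split+0 _) = -≤+ , +≤+ z≤n
split-digit (split+1 _) = -≤+ , +≤+ (s≤s z≤n)
split-digit (split+2 _) = -≤+ , +≤+ (s≤s (s≤s z≤n))
split-digit (split-2 _) = -≤- (s≤s z≤n) , -≤+
split-digit (split-1 _) = -≤- z≤n , -≤+

split-value : ∀ {x d q} → Split x d q → d ℤ.+ + (q * 4) ≡ + x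
split-value (split+0 _) = refl
split-value (split+1 _) = refl
split-value (split+2 _) = refl
split-value (split-2 _) = refl
split-value (split-1 _) = refl

split-lead : ∀ {x d} → Split x d 0 → d ≢ 0ℤ
split-lead (split+1 _) ()
split-lead (split+2 _) ()

split-quotient< : ∀ {x d q} → Split x d q → q ℕ.< x
split-quotient< (split+0 m) = s≤s (s≤s (≤-trans (m≤m*n m 4) (m≤n+m _ 2)))
split-quotient< (split+1 m) = s≤s (m≤m*n m 4)
split-quotient< (split+2 m) = s≤s (≤-trans (m≤m*n m 4) (n≤1+n _))
split-quotient< (split-2 m) = s≤s (s≤s (m≤m*n m 4))
split-quotient< (split-1 m) = s≤s (s≤s (≤-trans (m≤m*n m 4) (n≤1+n _)))

lowest-digit : ∀ {x q} d → BalDigit d → d ℤ.+ + (q * 4) ≡ + x → (d ≡ 0ℤ × q ≡ 0) ⊎ Split x d q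
lowest-digit {q = zero}  (+ 0) _ refl = inj₁ (refl , refl)
lowest-digit {q = suc q} (+ 0) _ refl = inj₂ (split+0 q)
lowest-digit (+ 1) _ refl = inj₂ (split+1 _)
lowest-digit (+ 2) _ refl = inj₂ (split+2 _)
lowest-digit (+ suc (suc (suc _))) (_ , +≤+ (s≤s (s≤s ()))) _
lowest-digit {q = zero}  -[1+ 0 ] _ ()
lowest-digit {q = suc q} -[1+ 0 ] _ refl = inj₂ (split-1 q)
lowest-digit {q = zero}  -[1+ 1 ] _ ()
lowest-digit {q = suc q} -[1+ 1 ] _ refl = inj₂ (split-2 q)
lowest-digit -[1+ suc (suc _) ] (-≤- (s≤s ()) , _) _

split-complete : ∀ {x d} v → BalDigit d → d ℤ.+ + 4 ℤ.* v ≡ + x →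
                 (d ≡ 0ℤ × v ≡ 0ℤ) ⊎ ∃[ q ] (v ≡ + q × Split x d q)
split-complete {d = d} (+ q) bd eq
  with lowest-digit {q = q} d bd (trans (cong (λ v → d ℤ.+ v) (sym (pos-4* q))) eq)
... | inj₁ (d≡0 , refl) = inj₁ (d≡0 , refl)
... | inj₂ sp           = inj₂ (q , refl , sp)
split-complete {d = d} -[1+ j ] (_ , d≤2) eq = contradiction (subst (_≤ -[1+ 1 ]) eq below) λ ()
  where
  below : d ℤ.+ + 4 ℤ.* -[1+ j ] ≤ -[1+ 1 ]
  below = ℤₚ.+-mono-≤ d≤2 (-≤- (≤-trans (*-monoʳ-≤ 3 (s≤s (z≤n {j}))) (m≤n+m _ j)))

noLeadingZero-[] : NoLeadingZero []
noLeadingZero-[] ([]    , ())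
noLeadingZero-[] (_ ∷ _ , ())

noLeadingZero-∷ : ∀ {d ds} → (ds ≡ [] → d ≢ 0ℤ) → NoLeadingZero ds → NoLeadingZero (d ∷ ds)
noLeadingZero-∷ lead _   ([]     , refl) = lead refl refl
noLeadingZero-∷ _    nlz (_ ∷ zs , refl) = nlz (zs , refl)

noLeadingZero-tail : ∀ {d ds} → NoLeadingZero (d ∷ ds) → NoLeadingZero ds
noLeadingZero-tail nlz (zs , refl) = nlz (_ ∷ zs , refl)

IsRep-∷⁺ : ∀ {x d q ds} → Split x d q → IsRep (+ q) ds → IsRep (+ x) (d ∷ ds)
IsRep-∷⁺ {x} {d} {q} {ds} sp (bds , nlz , val) = split-digit sp ∷ bds , noLeadingZero-∷ lead nlz , value
  where
  lead : ds ≡ [] → d ≢ 0ℤ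
  lead refl = split-lead (subst (Split x d) (sym (ℤₚ.+-injective val)) sp)
  value : d ℤ.+ + 4 ℤ.* valLE ds ≡ + x
  value = begin
    d ℤ.+ + 4 ℤ.* valLE ds ≡⟨ cong (λ v → d ℤ.+ + 4 ℤ.* v) val ⟩
    d ℤ.+ + 4 ℤ.* + q      ≡⟨ cong (λ v → d ℤ.+ v) (pos-4* q) ⟩
    d ℤ.+ + (q * 4)        ≡⟨ split-value sp ⟩
    + x                    ∎
    where open ≡-Reasoning

IsRep-zero : ∀ {ds} → IsRep 0ℤ ds → ds ≡ []
IsRep-∷⁻   : ∀ {x d ds} → IsRep (+ x) (d ∷ ds) → ∃[ q ] (Split x d q × IsRep (+ q) ds)

IsRep-zero {[]}    _ = refl
IsRep-zero {_ ∷ _} rep with IsRep-∷⁻ rep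
... | _ , () , _

IsRep-∷⁻ {ds = ds} (bd ∷ bds , nlz , val) with split-complete (valLE ds) bd val
... | inj₁ (refl , val′)   =
  contradiction ([] , cong (0ℤ ∷_) (IsRep-zero (bds , noLeadingZero-tail nlz , val′))) nlz
... | inj₂ (q , val′ , sp) = q , sp , bds , noLeadingZero-tail nlz , val′

IsRep-length≤ : ∀ {x ds} → IsRep (+ x) ds → length ds ℕ.≤ x
IsRep-length≤ {ds = []}    _   = z≤n
IsRep-length≤ {ds = _ ∷ _} rep with _ , sp , rep′ ← IsRep-∷⁻ rep =
  ≤-trans (s≤s (IsRep-length≤ rep′)) (split-quotient< sp)

-- reps f x lists the representations of + x with fewer than f digits.
reps : ℕ → ℕ → List (List ℤ)
reps zero    _ = []
reps (suc f) x with base4 x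
... | 4* zero +0  = [ [] ]
... | 4* suc m +0 = map (+ 0 ∷_) (reps f (suc m))
... | 4* m +1     = map (+ 1 ∷_) (reps f m)
... | 4* m +2     = map (+ 2 ∷_) (reps f m) ++ map (-[1+ 1 ] ∷_) (reps f (suc m))
... | 4* m +3     = map (-[1+ 0 ] ∷_) (reps f (suc m))

count : ℕ → ℕ → ℕ
count zero    _ = 0
count (suc f) x with base4 x
... | 4* zero +0  = 1
... | 4* suc m +0 = count f (suc m)
... | 4* m +1     = count f m
... | 4* m +2     = count f m + count f (suc m)
... | 4* m +3     = count f (suc m)

length-reps : ∀ f x → length (reps f x) ≡ count f x
length-reps zero    _ = refl
length-reps (suc f) x with base4 x
... | 4* zero +0  = refl
... | 4* suc m +0 = trans (length-map _ (reps f (suc m))) (length-reps f (suc m))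
... | 4* m +1     = trans (length-map _ (reps f m)) (length-reps f m)
... | 4* m +2     = trans (length-++ (map (+ 2 ∷_) (reps f m)))
                      (cong₂ _+_ (trans (length-map _ (reps f m)) (length-reps f m))
                                 (trans (length-map _ (reps f (suc m))) (length-reps f (suc m))))
... | 4* m +3     = trans (length-map _ (reps f (suc m))) (length-reps f (suc m))

IsRep-∷⁺-map : ∀ {x d q xss ds} → Split x d q → (∀ {es} → es ∈ xss → IsRep (+ q) es) →
               ds ∈ map (d ∷_) xss → IsRep (+ x) ds
IsRep-∷⁺-map sp sound ds∈ with _ , es∈ , refl ← ∈-map⁻ _ ds∈ = IsRep-∷⁺ sp (sound es∈)

reps-sound : ∀ f x {ds} → ds ∈ reps f x → IsRep (+ x) ds
reps-sound (suc f) x ds∈ with base4 x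
... | 4* zero +0 with here refl ← ds∈ = [] , noLeadingZero-[] , refl
... | 4* suc m +0 = IsRep-∷⁺-map (split+0 m) (reps-sound f (suc m)) ds∈
... | 4* m +1     = IsRep-∷⁺-map (split+1 m) (reps-sound f m) ds∈
... | 4* m +2     = [ IsRep-∷⁺-map (split+2 m) (reps-sound f m)
                    , IsRep-∷⁺-map (split-2 m) (reps-sound f (suc m)) ]′ (∈-++⁻ (map (+ 2 ∷_) (reps f m)) ds∈)
... | 4* m +3     = IsRep-∷⁺-map (split-1 m) (reps-sound f (suc m)) ds∈

∈-reps-∷ : ∀ {f x d q ds} → Split x d q → ds ∈ reps f q → d ∷ ds ∈ reps (suc f) x
∈-reps-∷     (split+0 m) ds∈ rewrite base4-m*4 m = ∈-map⁺ _ ds∈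
∈-reps-∷     (split+1 m) ds∈ rewrite base4-m*4 m = ∈-map⁺ _ ds∈
∈-reps-∷     (split+2 m) ds∈ rewrite base4-m*4 m = ∈-++⁺ˡ (∈-map⁺ _ ds∈)
∈-reps-∷ {f} (split-2 m) ds∈ rewrite base4-m*4 m = ∈-++⁺ʳ (map (+ 2 ∷_) (reps f m)) (∈-map⁺ _ ds∈)
∈-reps-∷     (split-1 m) ds∈ rewrite base4-m*4 m = ∈-map⁺ _ ds∈

reps-complete : ∀ {f x ds} → IsRep (+ x) ds → length ds ℕ.< f → ds ∈ reps f x
reps-complete {suc f} {ds = []}    (_ , _ , refl) _ = here refl
reps-complete {suc f} {ds = _ ∷ _} rep (s≤s len<f) with _ , sp , rep′ ← IsRep-∷⁻ rep =
  ∈-reps-∷ sp (reps-complete rep′ len<f)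

heads-disjoint : ∀ {d e : ℤ} {xss yss} → d ≢ e → Disjoint (map (d ∷_) xss) (map (e ∷_) yss)
heads-disjoint d≢e (ds∈ , es∈) with _ , _ , refl ← ∈-map⁻ _ ds∈ | _ , _ , eq ← ∈-map⁻ _ es∈ =
  d≢e (∷-injectiveˡ eq)

reps-unique : ∀ f x → Unique (reps f x)
reps-unique zero    _ = []
reps-unique (suc f) x with base4 x
... | 4* zero +0  = [] ∷ []
... | 4* suc m +0 = Unique.map⁺ ∷-injectiveʳ (reps-unique f (suc m))
... | 4* m +1     = Unique.map⁺ ∷-injectiveʳ (reps-unique f m)
... | 4* m +2     = Unique.++⁺ (Unique.map⁺ ∷-injectiveʳ (reps-unique f m))
                               (Unique.map⁺ ∷-injectiveʳ (reps-unique f (suc m))) (heads-disjoint λ ())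
... | 4* m +3     = Unique.map⁺ ∷-injectiveʳ (reps-unique f (suc m))

B4-count : ∀ {f x} → x ℕ.< f → B4 (+ x) (count f x)
B4-count {f} {x} x<f =
  reps f x , reps-unique f x , (λ _ → reps-sound f x) ,
  (λ _ rep → reps-complete rep (≤-<-trans (IsRep-length≤ rep) x<f)) , length-reps f x

B4-unique : ∀ {n k k′} → B4 n k → B4 n k′ → k ≡ k′
B4-unique (L , uL , sL , cL , refl) (M , uM , sM , cM , refl) =
  ≤-antisym (Unique⇒⊆⇒length≤ uL (λ ds∈ → cM _ (sL _ ds∈))) (Unique⇒⊆⇒length≤ uM (λ ds∈ → cL _ (sM _ ds∈)))

map-neg-involutive : ∀ ds → map -_ (map -_ ds) ≡ ds
map-neg-involutive []       = refl
map-neg-involutive (d ∷ ds) = cong₂ _∷_ (ℤₚ.neg-involutive d) (map-neg-involutive ds)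

valLE-neg : ∀ ds → valLE (map -_ ds) ≡ - valLE ds
valLE-neg []       = refl
valLE-neg (d ∷ ds) = begin
  - d ℤ.+ + 4 ℤ.* valLE (map -_ ds) ≡⟨ cong (λ v → - d ℤ.+ + 4 ℤ.* v) (valLE-neg ds) ⟩
  - d ℤ.+ + 4 ℤ.* - valLE ds        ≡⟨ cong (λ v → - d ℤ.+ v) (sym (ℤₚ.neg-distribʳ-* (+ 4) (valLE ds))) ⟩
  - d ℤ.+ - (+ 4 ℤ.* valLE ds)      ≡⟨ sym (ℤₚ.neg-distrib-+ d (+ 4 ℤ.* valLE ds)) ⟩
  - (d ℤ.+ + 4 ℤ.* valLE ds)        ∎
  where open ≡-Reasoning

IsRep-neg : ∀ {n ds} → IsRep n ds → IsRep (- n) (map -_ ds)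
IsRep-neg {n} {ds} (bds , nlz , val) =
  map⁺ (All.map balDigit-neg bds) , nlz′ , trans (valLE-neg ds) (cong -_ val)
  where
  balDigit-neg : ∀ {d} → BalDigit d → BalDigit (- d)
  balDigit-neg (-2≤d , d≤2) = ℤₚ.neg-mono-≤ d≤2 , ℤₚ.neg-mono-≤ -2≤d
  nlz′ : NoLeadingZero (map -_ ds)
  nlz′ (zs , eq) = nlz (map -_ zs , (begin
    ds                 ≡⟨ sym (map-neg-involutive ds) ⟩
    map -_ (map -_ ds) ≡⟨ cong (map -_) eq ⟩
    map -_ (zs ∷ʳ 0ℤ)  ≡⟨ map-++ -_ zs [ 0ℤ ] ⟩
    map -_ zs ∷ʳ 0ℤ    ∎))
    where open ≡-Reasoning

B4-neg : ∀ {n k} → B4 n k → B4 (- n) k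
B4-neg {n} (L , uL , sL , cL , len) =
  map (map -_) L , Unique.map⁺ (map-injective ℤₚ.neg-injective) uL , sound , complete , trans (length-map _ L) len
  where
  sound : ∀ ds → ds ∈ map (map -_) L → IsRep (- n) ds
  sound ds ds∈ with es , es∈ , refl ← ∈-map⁻ _ ds∈ = IsRep-neg (sL es es∈)
  complete : ∀ ds → IsRep (- n) ds → ds ∈ map (map -_) L
  complete ds rep = subst (_∈ map (map -_) L) (map-neg-involutive ds)
    (∈-map⁺ _ (cL _ (subst (λ m → IsRep m (map -_ ds)) (ℤₚ.neg-involutive n) (IsRep-neg rep))))

B4-∣∣ : ∀ {n k} → B4 n k → B4 (+ ∣ n ∣) k
B4-∣∣ {n = + _}      b = b
B4-∣∣ {n = -[1+ _ ]} b = B4-neg b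

fib-pos : ∀ n → 1 ℕ.≤ fib (suc n)
fib-pos zero    = ≤-refl
fib-pos (suc n) = ≤-trans (fib-pos n) (m≤m+n _ _)

fib-≤-suc : ∀ n → fib (suc n) ℕ.≤ fib (suc (suc n))
fib-≤-suc n = m≤m+n _ _

repunit : ℕ → ℕ
repunit zero    = 0
repunit (suc s) = 1 + repunit s * 4

repunit-≤-suc : ∀ s → repunit s ℕ.≤ repunit (suc s)
repunit-≤-suc s = ≤-trans (m≤m*n (repunit s) 4) (n≤1+n _)

r+m*4<n*4⇒m<n : ∀ r {m n} → r + m * 4 ℕ.< n * 4 → m ℕ.< n
r+m*4<n*4⇒m<n r {m} {n} lt = *-cancelʳ-< 4 m n (≤-<-trans (m≤n+m (m * 4) r) lt)

count≤fib       : ∀ s f k → k ℕ.≤ repunit s → count f k ℕ.≤ fib (suc s)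
count+count≤fib : ∀ s f k → k ℕ.< repunit s → count f k + count f (suc k) ℕ.≤ fib (suc (suc s))

count≤fib zero    zero    _ _   = z≤n
count≤fib zero    (suc f) _ z≤n = ≤-refl
count≤fib (suc s) zero    _ _   = z≤n
count≤fib (suc s) (suc f) k k≤ with base4 k
... | 4* zero +0  = fib-pos (suc s)
... | 4* suc m +0 = ≤-trans (count≤fib s f (suc m) (r+m*4<n*4⇒m<n 2 (ℕ.≤-pred k≤))) (fib-≤-suc s)
... | 4* m +1     = ≤-trans (count≤fib s f m (*-cancelʳ-≤ m _ 4 (ℕ.≤-pred k≤))) (fib-≤-suc s)
... | 4* m +2     = count+count≤fib s f m (r+m*4<n*4⇒m<n 0 (ℕ.≤-pred k≤))
... | 4* m +3     = ≤-trans (count≤fib s f (suc m) (r+m*4<n*4⇒m<n 1 (ℕ.≤-pred k≤))) (fib-≤-suc s)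

count+count≤fib zero    _       _ ()
count+count≤fib (suc s) zero    _ _ = z≤n
count+count≤fib (suc s) (suc f) k (s≤s k≤) with base4 k
... | 4* zero +0  = +-mono-≤ (fib-pos (suc s)) (count≤fib s f 0 z≤n)
... | 4* suc m +0 = +-mono-≤ (≤-trans bound (fib-≤-suc s)) bound
  where bound = count≤fib s f (suc m) (*-cancelʳ-≤ (suc m) _ 4 k≤)
... | 4* m +1     = ≤-trans (+-mono-≤ (count≤fib s f m (<⇒≤ m<)) (count+count≤fib s f m m<))
                            (≤-reflexive (+-comm (fib (suc s)) (fib (suc (suc s)))))
  where m< = r+m*4<n*4⇒m<n 0 k≤
... | 4* m +2     = +-mono-≤ (count+count≤fib s f m m<) (count≤fib s f (suc m) m<)
  where m< = r+m*4<n*4⇒m<n 1 k≤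
... | 4* m +3     = +-mono-≤ (≤-trans bound (fib-≤-suc s)) bound
  where bound = count≤fib s f (suc m) (r+m*4<n*4⇒m<n 2 k≤)

B4⇒≤fib : ∀ s {n k} → ∣ n ∣ ℕ.≤ repunit s → B4 n k → k ℕ.≤ fib (suc s)
B4⇒≤fib s {n} ∣n∣≤ b rewrite B4-unique (B4-∣∣ b) (B4-count (n<1+n ∣ n ∣)) = count≤fib s _ ∣ n ∣ ∣n∣≤

valBE-∷ʳ : ∀ ds d {a} → valBE ds ≡ + a → valBE (ds ∷ʳ + d) ≡ + (d + a * 4)
valBE-∷ʳ ds d {a} val = begin
  valBE (ds ∷ʳ + d)        ≡⟨ foldl-∷ʳ _ 0ℤ (+ d) ds ⟩
  + 4 ℤ.* valBE ds ℤ.+ + d ≡⟨ cong (λ v → + 4 ℤ.* v ℤ.+ + d) val ⟩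
  + 4 ℤ.* + a ℤ.+ + d      ≡⟨ cong (λ v → v ℤ.+ + d) (pos-4* a) ⟩
  + (a * 4 + d)            ≡⟨ cong +_ (+-comm (a * 4) d) ⟩
  + (d + a * 4)            ∎
  where open ≡-Reasoning

replicate-∷ʳ : ∀ {a} {A : Set a} m (x : A) → replicate (suc m) x ≡ replicate m x ∷ʳ x
replicate-∷ʳ zero    x = refl
replicate-∷ʳ (suc m) x = cong (x ∷_) (replicate-∷ʳ m x)

valBE-ones : ∀ m → valBE (ones m) ≡ + repunit m
valBE-ones zero    = refl
valBE-ones (suc m) = trans (cong valBE (replicate-∷ʳ m (+ 1))) (valBE-∷ʳ (ones m) 1 (valBE-ones m))

∣∣≤repunit : ∀ s {n} → - valBE (ones s) ≤ n → n ≤ valBE (ones (suc s)) → ∣ n ∣ ℕ.≤ repunit (suc s)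
∣∣≤repunit s {n = + _}      _    n≤ = ℤₚ.drop‿+≤+ (subst (_ ≤_) (valBE-ones (suc s)) n≤)
∣∣≤repunit s {n = -[1+ x ]} -a≤n _  = ≤-trans (ℤₚ.drop‿+≤+ x<a) (repunit-≤-suc s)
  where
  x<a : + suc x ≤ + repunit s
  x<a = subst (+ suc x ≤_) (trans (ℤₚ.neg-involutive _) (valBE-ones s)) (ℤₚ.neg-mono-≤ -a≤n)

attained-in-interval : ∀ s {n x k} → n ≡ + x → x ℕ.≤ repunit (suc s) → B4 n k →
                       ∃ λ n → (- valBE (ones s) ≤ n) × (n ≤ valBE (ones (suc s))) × B4 n k
attained-in-interval s {x = x} refl x≤ b = + x , lower , upper , b
  where
  lower = subst (λ v → - v ≤ + x) (sym (valBE-ones s)) ℤₚ.neg-≤-pos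
  upper = subst (+ x ≤_) (sym (valBE-ones (suc s))) (+≤+ x≤)

⟦12⟧ : ℕ → ℕ
⟦12⟧ zero    = 0
⟦12⟧ (suc t) = 2 + (1 + ⟦12⟧ t * 4) * 4

⟦12⟧2 : ℕ → ℕ
⟦12⟧2 t = 2 + ⟦12⟧ t * 4

blk12-∷ʳ : ∀ t → blk12 (suc t) ≡ blk12 t ∷ʳ + 1 ∷ʳ + 2
blk12-∷ʳ zero    = refl
blk12-∷ʳ (suc t) = cong (λ ds → + 1 ∷ + 2 ∷ ds) (blk12-∷ʳ t)

valBE-blk12 : ∀ t → valBE (blk12 t) ≡ + ⟦12⟧ t
valBE-blk12 zero    = refl
valBE-blk12 (suc t) =
  trans (cong valBE (blk12-∷ʳ t)) (valBE-∷ʳ (blk12 t ∷ʳ + 1) 2 (valBE-∷ʳ (blk12 t) 1 (valBE-blk12 t)))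

valBE-blk12-2 : ∀ t → valBE (blk12 t ++ [ + 2 ]) ≡ + ⟦12⟧2 t
valBE-blk12-2 t = valBE-∷ʳ (blk12 t) 2 (valBE-blk12 t)

2+m*4<1+n*4 : ∀ {m n} → m ℕ.< n → 2 + m * 4 ℕ.< 1 + n * 4
2+m*4<1+n*4 {m} m<n = s≤s (≤-trans (m≤n+m (2 + m * 4) 2) (*-monoˡ-≤ 4 m<n))

⟦12⟧<repunit : ∀ t → ⟦12⟧ t ℕ.< repunit (1 + t * 2)
⟦12⟧<repunit zero    = s≤s z≤n
⟦12⟧<repunit (suc t) = 2+m*4<1+n*4 (s≤s (*-monoˡ-< 4 (⟦12⟧<repunit t)))

⟦12⟧2<repunit : ∀ t → ⟦12⟧2 t ℕ.< repunit (2 + t * 2)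
⟦12⟧2<repunit t = 2+m*4<1+n*4 (⟦12⟧<repunit t)

count-1+m*4 : ∀ f m → count (suc f) (1 + m * 4) ≡ count f m
count-1+m*4 f m rewrite base4-m*4 m = refl

count-2+m*4 : ∀ f m → count (suc f) (2 + m * 4) ≡ count f m + count f (suc m)
count-2+m*4 f m rewrite base4-m*4 m = refl

count-3+m*4 : ∀ f m → count (suc f) (3 + m * 4) ≡ count f (suc m)
count-3+m*4 f m rewrite base4-m*4 m = refl

count-⟦12⟧   : ∀ t f → count (2 + t * 2 + f) (⟦12⟧ t) ≡ fib (2 + t * 2)
count-1+⟦12⟧ : ∀ t f → count (2 + t * 2 + f) (1 + ⟦12⟧ t) ≡ fib (1 + t * 2)
count-⟦12⟧2  : ∀ t f → count (3 + t * 2 + f) (⟦12⟧2 t) ≡ fib (3 + t * 2)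

count-⟦12⟧ zero    f = refl
count-⟦12⟧ (suc t) f = begin
  count (4 + t * 2 + f) (2 + (1 + ⟦12⟧ t * 4) * 4)
    ≡⟨ count-2+m*4 _ (1 + ⟦12⟧ t * 4) ⟩
  count (3 + t * 2 + f) (1 + ⟦12⟧ t * 4) + count (3 + t * 2 + f) (⟦12⟧2 t)
    ≡⟨ cong₂ _+_ (count-1+m*4 _ (⟦12⟧ t)) (count-⟦12⟧2 t f) ⟩
  count (2 + t * 2 + f) (⟦12⟧ t) + fib (3 + t * 2)
    ≡⟨ cong (_+ fib (3 + t * 2)) (count-⟦12⟧ t f) ⟩
  fib (2 + t * 2) + fib (3 + t * 2)
    ≡⟨ +-comm (fib (2 + t * 2)) _ ⟩
  fib (4 + t * 2)
    ∎
  where open ≡-Reasoning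

count-1+⟦12⟧ zero    f = refl
count-1+⟦12⟧ (suc t) f = trans (count-3+m*4 _ (1 + ⟦12⟧ t * 4)) (count-⟦12⟧2 t f)

count-⟦12⟧2 t f = trans (count-2+m*4 _ (⟦12⟧ t)) (cong₂ _+_ (count-⟦12⟧ t f) (count-1+⟦12⟧ t f))

B4-blk12 : ∀ t → B4 (valBE (blk12 t)) (fib (2 + t * 2))
B4-blk12 t =
  subst₂ B4 (sym (valBE-blk12 t)) (count-⟦12⟧ t (⟦12⟧ t)) (B4-count (m<n+m (⟦12⟧ t) {2 + t * 2} z<s))

B4-blk12-2 : ∀ t → B4 (valBE (blk12 t ++ [ + 2 ])) (fib (3 + t * 2))
B4-blk12-2 t =
  subst₂ B4 (sym (valBE-blk12-2 t)) (count-⟦12⟧2 t (⟦12⟧2 t)) (B4-count (m<n+m (⟦12⟧2 t) {3 + t * 2} z<s))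

data EvenOdd : ℕ → Set where
  even : ∀ u → EvenOdd (u * 2)
  odd  : ∀ u → EvenOdd (1 + u * 2)

evenOdd : ∀ r → EvenOdd r
evenOdd zero = even 0
evenOdd (suc r) with evenOdd r
... | even u = odd u
... | odd u  = even (suc u)

⌊n*2/2⌋≡n : ∀ n → ⌊ n * 2 /2⌋ ≡ n
⌊n*2/2⌋≡n zero    = refl
⌊n*2/2⌋≡n (suc n) = cong suc (⌊n*2/2⌋≡n n)

-- Rewriting r + k to k + r makes the lengths and Fibonacci
-- indices compute, so the lemmas above apply to them without further conversion.
theorem1p4 : (r : ℕ) → 1 Data.Nat.≤ r →
    (r % 2 ≡ 1 → B4 (valBE (blk12 ⌈ r /2⌉)) (fib (r + 3)))
    × (r % 2 ≡ 0 → B4 (valBE (blk12 (r / 2) ++ (+ 2 ∷ []))) (fib (r + 3)))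
    × (∃ λ n → (- valBE (ones (r + 1)) ≤ n) × (n ≤ valBE (ones (r + 2))) × B4 n (fib (r + 3)))
    × (∀ (n : ℤ) (k : ℕ) → - valBE (ones (r + 1)) ≤ n → n ≤ valBE (ones (r + 2)) →
    B4 n k → k Data.Nat.≤ fib (r + 3))
theorem1p4 r _ rewrite +-comm r 1 | +-comm r 2 | +-comm r 3 with evenOdd r
... | even u =
    (λ r%2≡1 → contradiction (trans (sym (m*n%n≡0 u 2)) r%2≡1) 0≢1+n)
  , (λ _ → subst (λ t → B4 (valBE (blk12 t ++ [ + 2 ])) (fib (3 + u * 2))) (sym (m*n/n≡m u 2)) (B4-blk12-2 u))
  , attained-in-interval (suc r) (valBE-blk12-2 u) (<⇒≤ (⟦12⟧2<repunit u)) (B4-blk12-2 u)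
  , λ _ _ lo hi → B4⇒≤fib (2 + r) (∣∣≤repunit (1 + r) lo hi)
... | odd u =
    (λ _ → subst (λ t → B4 (valBE (blk12 t)) (fib (4 + u * 2))) (cong suc (sym (⌊n*2/2⌋≡n u))) (B4-blk12 (suc u)))
  , (λ r%2≡0 → contradiction (trans (sym ([m+kn]%n≡m%n 1 u 2)) r%2≡0) 1+n≢0)
  , attained-in-interval (suc r) (valBE-blk12 (suc u)) (<⇒≤ (⟦12⟧<repunit (suc u))) (B4-blk12 (suc u))
  , λ _ _ lo hi → B4⇒≤fib (2 + r) (∣∣≤repunit (1 + r) lo hi)
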